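{- Let $K$ be a field of characteristic different from $2$ and $\psi:K\times K\to K$ a function with $\psi(x,y)=\psi(y,x)$ and $\psi(x+z,y+z)=\psi(x,y)$ for all $x,y,z\in K$. For $m\ge 0$ and $y_1,\ldots,y_{2m}\in K$ let $pf_{2m}(y_1,\ldots,y_{2m})$ denote the Pfaffian of the triangular array $(\psi(y_i,y_j))_{1\le i<j\le 2m}$ (with $pf_0=1$). Then for every $n\ge 1$, all $x_1,\ldots,x_{2n}\in K$ and every $1\le s\le 2n$, $$pf_{2n}(x_1,\ldots,x_{s-1},x_s,x_s,x_{s+2},\ldots,x_{2n})=c\; pf_{2n-2}(x_1,\ldots,x_{s-1},x_{s+2},\ldots,x_{2n}),$$ where $c=\psi(0,0)$; i.e. if the $(s+1)$-st argument equals the $s$-th, the Pfaffian equals $c$ times the Pfaffian of the remaining $2n-2$ arguments (in their original order). Here indices are cyclic: $x_{2n+1}=x_1$, so for $s=2n$ the statement concerns setting $x_1=x_{2n}$ and removing the arguments in positions $1$ and $2n$.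
   Context: For a triangular array $\bar A=(a_{i,j})_{1\le i<j\le 2m}$ its Pfaffian is $pf_{2m}\bar A=\sum_{\pi}\operatorname{sign}(\pi)\,a_{i_1,j_1}\cdots a_{i_m,j_m}$, the sum over all permutations $\pi\in S_{2m}$ with one-line notation $(i_1,j_1,\ldots,i_m,j_m)$ satisfying $i_1<i_2<\cdots<i_m$ and $i_s<j_s$ for all $s$; $\operatorname{sign}(\pi)$ is the sign of the permutation. -}

module Defs where

open import Level using (Level)
open import Algebra.Bundles using (CommutativeRing)
open import Data.Bool using (Bool; true; false; _∧_; if_then_else_)
open import Data.Nat as ℕ using (ℕ; zero; suc)
open import Data.Nat.Properties using (_<?_)
open import Data.Fin using (Fin; toℕ)
open import Data.List using (List; []; _∷_; map; concatMap; foldr; filterᵇ; allFin; length; lookup)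
open import Data.Product using (_×_; _,_; Σ)
open import Relation.Nullary using (¬_)
open import Relation.Nullary.Decidable using (⌊_⌋; does)

module _ {c ℓ : Level} (R : CommutativeRing c ℓ) where
  open CommutativeRing R

  IsField : Set (c Level.⊔ ℓ)
  IsField = (¬ (0# ≈ 1#)) × (∀ x → ¬ (x ≈ 0#) → Σ Carrier (λ y → x * y ≈ 1#))

  CharNot2 : Set ℓ
  CharNot2 = ¬ (1# + 1# ≈ 0#)

insertions : {A : Set} → A → List A → List (List A)
insertions x [] = (x ∷ []) ∷ []
insertions x (y ∷ ys) = (x ∷ y ∷ ys) ∷ map (y ∷_) (insertions x ys)

perms : {A : Set} → List A → List (List A)
perms [] = [] ∷ []
perms (x ∷ xs) = concatMap (insertions x) (perms xs)

pairs : {A : Set} → List A → List (A × A)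
pairs (i ∷ j ∷ rest) = (i , j) ∷ pairs rest
pairs _ = []

_<ᵇ_ : {k : ℕ} → Fin k → Fin k → Bool
i <ᵇ j = does (toℕ i <? toℕ j)

incFirst : {k : ℕ} → List (Fin k × Fin k) → Bool
incFirst ((i , _) ∷ rest@((i' , _) ∷ _)) = (i <ᵇ i') ∧ incFirst rest
incFirst _ = true

allLt : {k : ℕ} → List (Fin k × Fin k) → Bool
allLt [] = true
allLt ((i , j) ∷ rest) = (i <ᵇ j) ∧ allLt rest

pfAdmissible : {k : ℕ} → List (Fin k) → Bool
pfAdmissible π = incFirst (pairs π) ∧ allLt (pairs π)

countBelow : {k : ℕ} → Fin k → List (Fin k) → ℕ
countBelow i [] = 0
countBelow i (j ∷ js) = (if j <ᵇ i then 1 else 0) ℕ.+ countBelow i js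

inversions : {k : ℕ} → List (Fin k) → ℕ
inversions [] = 0
inversions (i ∷ is) = countBelow i is ℕ.+ inversions is

isEven : ℕ → Bool
isEven zero = true
isEven (suc n) = not' (isEven n)
  where
  not' : Bool → Bool
  not' true = false
  not' false = true

module _ {c ℓ : Level} (R : CommutativeRing c ℓ) where
  open CommutativeRing R

  sign : {k : ℕ} → List (Fin k) → Carrier
  sign π = if isEven (inversions π) then 1# else - 1#

  -- Pfaffian of the triangular array (ψ(yᵢ,yⱼ))_{i<j} built from the sequence ys:
  -- sum over permutations π of {1,…,|ys|} in one-line notation (i₁,j₁,…,iₘ,jₘ)
  -- with i₁<…<iₘ and iₛ<jₛ, of sign(π)·ψ(y_{i₁},y_{j₁})⋯ψ(y_{iₘ},y_{jₘ}).
  -- (Used only for sequences of even length 2m; for ys = [] it is 1.)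
  pf : (Carrier → Carrier → Carrier) → List Carrier → Carrier
  pf ψ ys =
    foldr _+_ 0#
      (map (λ π → sign π * foldr _*_ 1#
                    (map (λ { (i , j) → ψ (lookup ys i) (lookup ys j) }) (pairs π)))
           (filterᵇ pfAdmissible (perms (allFin (length ys)))))

-- The Pfaffian of a list of length 2n equals its expansion along the first entry,
--   pf (x ∷ xs) = ∑ⱼ (-1)^(j-1) ψ(x, xⱼ) · pf (xs without xⱼ):
-- in an admissible permutation i₁ is the least index, and deleting the pair (i₁, j₁) lowers
-- the inversion count by the number of indices below j₁ among the others.
-- Expanding twice, along u and then along v, is antisymmetric in (u, v).
-- If y, y are adjacent, expand along the first entry: the two terms pairing it with either
-- copy of y cancel, so by induction the pair may be assumed to come first; there the
-- expansion is ψ(y, y) · pf(rest) minus a double expansion along y and y, which vanishes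
-- because 2 is invertible. Translation invariance gives ψ(y, y) = ψ(0, 0).
-- For the cyclic case, symmetry of ψ and the same antisymmetry show that moving the last
-- entry of an even list to the front does not change the Pfaffian.

module Submission where

open import Defs

open import Level using (Level)
open import Algebra.Bundles using (CommutativeRing)
open import Data.Nat using (ℕ; _≤_; _*_)
open import Data.List using (List; []; _∷_; _++_; length)
open import Data.Product using (_×_)
open import Relation.Binary.PropositionalEquality using (_≡_)

open import Data.Bool using (Bool; true; false; if_then_else_; T; _∧_)
open import Data.Bool.Properties using (∧-conicalˡ; ∧-conicalʳ)
open import Data.Empty using (⊥-elim)
open import Data.Fin using (Fin; toℕ; _<_)
open import Data.List using (map; foldr; concatMap; filterᵇ; allFin; lookup)
open import Data.List.Membership.Propositional using (_∈_)
open import Data.List.Properties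
  using (length-++-sucʳ; length-++-comm; map-cong; map-tabulate; length-tabulate; tabulate-lookup)
open import Data.List.Relation.Binary.Permutation.Propositional
  using (_↭_; ↭-refl; ↭-prep; ↭-swap; ↭-trans; ↭-sym)
import Data.List.Relation.Binary.Permutation.Propositional as ↭
open import Data.List.Relation.Binary.Permutation.Propositional.Properties
  using (All-resp-↭; ∈-resp-↭; ↭-length)
open import Data.List.Relation.Binary.Sublist.Propositional using (_⊆_; []; _∷_; _∷ʳ_; ⊆-refl)
open import Data.List.Relation.Binary.Sublist.Propositional.Properties using (All-resp-⊆)
open import Data.List.Relation.Unary.All as All using (All; []; _∷_)
open import Data.List.Relation.Unary.AllPairs using (AllPairs; []; _∷_)
open import Data.List.Relation.Unary.AllPairs.Properties using (tabulate⁺-<)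
open import Data.List.Relation.Unary.Any using (here; there)
open import Data.Nat using (zero; suc)
import Data.Nat as ℕ
open import Data.Nat.Properties using (suc-injective; +-suc; <-asym; _<?_)
import Data.Nat.Properties as ℕₚ
open import Data.Product using (_,_; proj₁; proj₂)
open import Data.Unit using (tt)
open import Function using (id)
import Relation.Binary.PropositionalEquality as ≡
open import Relation.Nullary.Decidable using (dec-true; dec-false)

double : ℕ → ℕ
double zero = zero
double (suc n) = suc (suc (double n))

double≡2* : ∀ n → double n ≡ 2 * n
double≡2* zero = ≡.refl
double≡2* (suc n) =
  ≡.cong suc (≡.trans (≡.cong suc (double≡2* n)) (≡.sym (+-suc n (n ℕ.+ 0))))

↭-length-∷ : ∀ {a} {A : Set a} {m : A} {r L n} → m ∷ r ↭ L → length L ≡ suc n → length r ≡ n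
↭-length-∷ m∷r↭L len = suc-injective (≡.trans (↭-length m∷r↭L) len)

module RingLemmas {c ℓ} (R : CommutativeRing c ℓ) where
  open CommutativeRing R renaming (_*_ to _·_) hiding (zero)
  open import Algebra.Properties.Ring ring
    using (-‿involutive; -‿+-comm; -0#≈0#; x[y-z]≈xy-xz; ⁻¹-anti-homo‿-)
  open import Algebra.Properties.CommutativeSemigroup +-commutativeSemigroup using (interchange)
  open import Algebra.Properties.CommutativeSemigroup *-commutativeSemigroup using (x∙yz≈y∙xz)
  open import Relation.Binary.Reasoning.Setoid setoid

  sub-cong : ∀ {x x′ y y′} → x ≈ x′ → y ≈ y′ → x - y ≈ x′ - y′
  sub-cong x≈x′ y≈y′ = +-cong x≈x′ (-‿cong y≈y′)

  x-[y-z]≈[x-y]+z : ∀ x y z → x - (y - z) ≈ (x - y) + z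
  x-[y-z]≈[x-y]+z x y z = begin
    x + - (y + - z)   ≈⟨ +-congˡ (sym (-‿+-comm y (- z))) ⟩
    x + (- y + - - z) ≈⟨ +-congˡ (+-congˡ (-‿involutive z)) ⟩
    x + (- y + z)     ≈⟨ sym (+-assoc x (- y) z) ⟩
    (x - y) + z       ∎

  x-[x-y]≈y : ∀ x y → x - (x - y) ≈ y
  x-[x-y]≈y x y = begin
    x - (x - y) ≈⟨ x-[y-z]≈[x-y]+z x x y ⟩
    (x - x) + y ≈⟨ +-congʳ (-‿inverseʳ x) ⟩
    0# + y      ≈⟨ +-identityˡ y ⟩
    y           ∎

  x-0≈x : ∀ x {y} → y ≈ 0# → x - y ≈ x
  x-0≈x x {y} y≈0 = begin
    x - y  ≈⟨ +-congˡ (-‿cong y≈0) ⟩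
    x - 0# ≈⟨ +-congˡ -0#≈0# ⟩
    x + 0# ≈⟨ +-identityʳ x ⟩
    x      ∎

  [x-[y-z]]+[y-[x-w]]≈z+w : ∀ x y z w → (x - (y - z)) + (y - (x - w)) ≈ z + w
  [x-[y-z]]+[y-[x-w]]≈z+w x y z w = begin
    (x - (y - z)) + (y - (x - w)) ≈⟨ +-cong (x-[y-z]≈[x-y]+z x y z) (x-[y-z]≈[x-y]+z y x w) ⟩
    ((x - y) + z) + ((y - x) + w) ≈⟨ interchange (x - y) z (y - x) w ⟩
    ((x - y) + (y - x)) + (z + w) ≈⟨ +-congʳ (+-congˡ (sym (⁻¹-anti-homo‿- x y))) ⟩
    ((x - y) - (x - y)) + (z + w) ≈⟨ +-congʳ (-‿inverseʳ (x - y)) ⟩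
    0# + (z + w)                  ≈⟨ +-identityˡ (z + w) ⟩
    z + w                         ∎

  [x-y]-[z-w]≈[x-z]-[y-w] : ∀ x y z w → (x - y) - (z - w) ≈ (x - z) - (y - w)
  [x-y]-[z-w]≈[x-z]-[y-w] x y z w = begin
    (x + - y) + - (z + - w)   ≈⟨ +-congˡ (sym (-‿+-comm z (- w))) ⟩
    (x + - y) + (- z + - - w) ≈⟨ interchange x (- y) (- z) (- - w) ⟩
    (x + - z) + (- y + - - w) ≈⟨ +-congˡ (-‿+-comm y (- w)) ⟩
    (x + - z) + - (y + - w)   ∎

  x[y-z]-[u-v]≈[xy-u]-[xz-v] : ∀ x y z u v → x · (y - z) - (u - v) ≈ (x · y - u) - (x · z - v)
  x[y-z]-[u-v]≈[xy-u]-[xz-v] x y z u v = begin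
    x · (y - z) - (u - v)     ≈⟨ +-congʳ (x[y-z]≈xy-xz x y z) ⟩
    (x · y - x · z) - (u - v) ≈⟨ [x-y]-[z-w]≈[x-z]-[y-w] (x · y) (x · z) u v ⟩
    (x · y - u) - (x · z - v) ∎

  x[ay]-az≈a[xy-z] : ∀ a x y z → x · (a · y) - a · z ≈ a · (x · y - z)
  x[ay]-az≈a[xy-z] a x y z = begin
    x · (a · y) - a · z ≈⟨ +-congʳ (x∙yz≈y∙xz x a y) ⟩
    a · (x · y) - a · z ≈⟨ sym (x[y-z]≈xy-xz a (x · y) z) ⟩
    a · (x · y - z)     ∎

  [xy][zw]≈x[z[yw]] : ∀ x y z w → (x · y) · (z · w) ≈ x · (z · (y · w))
  [xy][zw]≈x[z[yw]] x y z w = trans (*-assoc x y (z · w)) (*-congˡ (x∙yz≈y∙xz y z w))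


module Laplace {c ℓ a} (R : CommutativeRing c ℓ) {A : Set a}
               (ψ : A → A → CommutativeRing.Carrier R) where
  open CommutativeRing R renaming (_*_ to _·_) hiding (zero)
  open import Algebra.Properties.Ring ring using (-‿involutive; -‿+-comm; +-inverseˡ-unique)
  open RingLemmas R
  open import Relation.Binary.Reasoning.Setoid setoid

  -- laplace h v (z₁ ∷ … ∷ zᵣ) = ∑ⱼ (-1)^(j-1) ψ v zⱼ · h (the zᵢ with i ≠ j, in order).
  laplace : (List A → Carrier) → A → List A → Carrier
  laplace h v []       = 0#
  laplace h v (z ∷ zs) = ψ v z · h zs - laplace (λ w → h (z ∷ w)) v zs

  -- The Pfaffian of a list of n pairs, expanded along its first entry; meaningful only
  -- on lists of length 2n (pfRec 0 is 1 on every list).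
  pfRec : ℕ → List A → Carrier
  pfRec zero    _        = 1#
  pfRec (suc n) []       = 0#
  pfRec (suc n) (x ∷ xs) = laplace (pfRec n) x xs

  laplace-cong : ∀ {f g} v zs → (∀ w → suc (length w) ≡ length zs → f w ≈ g w) →
                 laplace f v zs ≈ laplace g v zs
  laplace-cong v []       f≈g = refl
  laplace-cong v (z ∷ zs) f≈g =
    sub-cong (*-congˡ (f≈g zs ≡.refl)) (laplace-cong v zs (λ w eq → f≈g (z ∷ w) (≡.cong suc eq)))

  laplace-scale : ∀ α f v zs → laplace (λ w → α · f w) v zs ≈ α · laplace f v zs
  laplace-scale α f v []       = sym (zeroʳ α)
  laplace-scale α f v (z ∷ zs) = begin
    ψ v z · (α · f zs) - laplace (λ w → α · f (z ∷ w)) v zs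
      ≈⟨ +-congˡ (-‿cong (laplace-scale α (λ w → f (z ∷ w)) v zs)) ⟩
    ψ v z · (α · f zs) - α · laplace (λ w → f (z ∷ w)) v zs
      ≈⟨ x[ay]-az≈a[xy-z] α (ψ v z) (f zs) _ ⟩
    α · laplace f v (z ∷ zs) ∎

  laplace-sub : ∀ f g v zs → laplace (λ w → f w - g w) v zs ≈ laplace f v zs - laplace g v zs
  laplace-sub f g v []       = sym (-‿inverseʳ 0#)
  laplace-sub f g v (z ∷ zs) = begin
    ψ v z · (f zs - g zs) - laplace (λ w → f (z ∷ w) - g (z ∷ w)) v zs
      ≈⟨ +-congˡ (-‿cong (laplace-sub (λ w → f (z ∷ w)) (λ w → g (z ∷ w)) v zs)) ⟩
    ψ v z · (f zs - g zs) - (laplace (λ w → f (z ∷ w)) v zs - laplace (λ w → g (z ∷ w)) v zs)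
      ≈⟨ x[y-z]-[u-v]≈[xy-u]-[xz-v] (ψ v z) (f zs) (g zs) _ _ ⟩
    laplace f v (z ∷ zs) - laplace g v (z ∷ zs) ∎

  -- The terms pairing the head z with u and with v cancel; what is left is the same
  -- statement for the tail.
  laplace²-antisym : ∀ h u v zs → laplace (laplace h v) u zs + laplace (laplace h u) v zs ≈ 0#
  laplace²-antisym h u v []       = +-identityˡ 0#
  laplace²-antisym h u v (z ∷ zs) = begin
    laplace (laplace h v) u (z ∷ zs) + laplace (laplace h u) v (z ∷ zs)
      ≈⟨ +-cong (expandHead u v) (expandHead v u) ⟩
    (ψ u z · laplace h v zs - (ψ v z · laplace h u zs - laplace (laplace h′ v) u zs)) +
    (ψ v z · laplace h u zs - (ψ u z · laplace h v zs - laplace (laplace h′ u) v zs))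
      ≈⟨ [x-[y-z]]+[y-[x-w]]≈z+w _ _ _ _ ⟩
    laplace (laplace h′ v) u zs + laplace (laplace h′ u) v zs
      ≈⟨ laplace²-antisym h′ u v zs ⟩
    0# ∎
    where
    h′ : List A → Carrier
    h′ w = h (z ∷ w)

    expandHead : ∀ u v → laplace (laplace h v) u (z ∷ zs) ≈
                 ψ u z · laplace h v zs - (ψ v z · laplace h u zs - laplace (laplace h′ v) u zs)
    expandHead u v = +-congˡ (-‿cong (begin
      laplace (λ w → ψ v z · h w - laplace h′ v w) u zs
        ≈⟨ laplace-sub (λ w → ψ v z · h w) (laplace h′ v) u zs ⟩
      laplace (λ w → ψ v z · h w) u zs - laplace (laplace h′ v) u zs
        ≈⟨ +-congʳ (laplace-scale (ψ v z) h u zs) ⟩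
      ψ v z · laplace h u zs - laplace (laplace h′ v) u zs ∎))

  laplace-dupHead : ∀ h x y zs → laplace h x (y ∷ y ∷ zs) ≈ laplace (λ w → h (y ∷ y ∷ w)) x zs
  laplace-dupHead h x y zs = x-[x-y]≈y _ _

  module _ (y : A) where
    laplace-insertDup :
      ∀ κ h g m → (∀ p q → length (p ++ q) ≡ m → h (p ++ y ∷ y ∷ q) ≈ κ · g (p ++ q)) →
      ∀ x xs zs → length (xs ++ zs) ≡ suc m →
      laplace h x (xs ++ y ∷ y ∷ zs) ≈ κ · laplace g x (xs ++ zs)
    laplace-insertDup κ h g m hyp x [] zs len = begin
      laplace h x (y ∷ y ∷ zs)                 ≈⟨ laplace-dupHead h x y zs ⟩
      laplace (λ w → h (y ∷ y ∷ w)) x zs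
        ≈⟨ laplace-cong x zs (λ w eq → hyp [] w (suc-injective (≡.trans eq len))) ⟩
      laplace (λ w → κ · g w) x zs             ≈⟨ laplace-scale κ g x zs ⟩
      κ · laplace g x zs                       ∎
    laplace-insertDup κ h g zero hyp x (z ∷ []) [] len = begin
      ψ x z · h (y ∷ y ∷ []) - laplace (λ w → h (z ∷ w)) x (y ∷ y ∷ [])
        ≈⟨ sub-cong (*-congˡ (hyp [] [] ≡.refl))
                    (trans (laplace-dupHead (λ w → h (z ∷ w)) x y []) (sym (zeroʳ κ))) ⟩
      ψ x z · (κ · g []) - κ · 0#              ≈⟨ x[ay]-az≈a[xy-z] κ (ψ x z) (g []) 0# ⟩
      κ · laplace g x (z ∷ [])                 ∎
    laplace-insertDup κ h g (suc m) hyp x (z ∷ xs) zs len = begin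
      ψ x z · h (xs ++ y ∷ y ∷ zs) - laplace (λ w → h (z ∷ w)) x (xs ++ y ∷ y ∷ zs)
        ≈⟨ sub-cong (*-congˡ (hyp xs zs (suc-injective len)))
                    (laplace-insertDup κ (λ w → h (z ∷ w)) (λ w → g (z ∷ w)) m
                       (λ p q eq → hyp (z ∷ p) q (≡.cong suc eq)) x xs zs (suc-injective len)) ⟩
      ψ x z · (κ · g (xs ++ zs)) - κ · laplace (λ w → g (z ∷ w)) x (xs ++ zs)
        ≈⟨ x[ay]-az≈a[xy-z] κ (ψ x z) _ _ ⟩
      κ · laplace g x (z ∷ xs ++ zs) ∎

    module _ (x+x≈0⇒x≈0 : ∀ x → x + x ≈ 0# → x ≈ 0#) where
      pfRec-dup : ∀ n xs zs → length (xs ++ zs) ≡ double n →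
                  pfRec (suc n) (xs ++ y ∷ y ∷ zs) ≈ ψ y y · pfRec n (xs ++ zs)
      pfRec-dup zero    []       []  _   = x-0≈x _ refl
      pfRec-dup (suc n) []       zs  _   =
        x-0≈x _ (x+x≈0⇒x≈0 _ (laplace²-antisym (pfRec n) y y zs))
      pfRec-dup (suc n) (x ∷ xs) zs len =
        laplace-insertDup (ψ y y) (pfRec (suc n)) (pfRec n) (double n) (pfRec-dup n)
                          x xs zs (suc-injective len)

  negateByLength : List A → Carrier → Carrier
  negateByLength []      t = t
  negateByLength (_ ∷ w) t = - negateByLength w t

  negateByLength-even : ∀ n w t → length w ≡ double n → negateByLength w t ≈ t
  negateByLength-even zero    []          t _   = refl
  negateByLength-even (suc n) (_ ∷ _ ∷ w) t len =
    trans (-‿involutive _) (negateByLength-even n w t (suc-injective (suc-injective len)))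

  laplace-snoc : ∀ h x y w → laplace h x (w ++ y ∷ []) ≈
                 laplace (λ u → h (u ++ y ∷ [])) x w + negateByLength w (ψ x y · h w)
  laplace-snoc h x y []      = trans (x-0≈x _ refl) (sym (+-identityˡ _))
  laplace-snoc h x y (z ∷ w) = begin
    ψ x z · h (w ++ y ∷ []) - laplace (λ u → h (z ∷ u)) x (w ++ y ∷ [])
      ≈⟨ +-congˡ (-‿cong (laplace-snoc (λ u → h (z ∷ u)) x y w)) ⟩
    ψ x z · h (w ++ y ∷ []) -
      (laplace (λ u → h (z ∷ u ++ y ∷ [])) x w + negateByLength w (ψ x y · h (z ∷ w)))
      ≈⟨ +-congˡ (sym (-‿+-comm _ _)) ⟩
    ψ x z · h (w ++ y ∷ []) +
      (- laplace (λ u → h (z ∷ u ++ y ∷ [])) x w + - negateByLength w (ψ x y · h (z ∷ w)))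
      ≈⟨ sym (+-assoc _ _ _) ⟩
    laplace (λ u → h (u ++ y ∷ [])) x (z ∷ w) + negateByLength (z ∷ w) (ψ x y · h (z ∷ w)) ∎

  module _ (ψ-sym : ∀ x y → ψ x y ≈ ψ y x) where
    pfRec-rotate : ∀ n y w → suc (length w) ≡ double n → pfRec n (w ++ y ∷ []) ≈ pfRec n (y ∷ w)
    pfRec-rotate (suc zero) y (x ∷ []) _ = sub-cong (*-congʳ (ψ-sym x y)) refl
    pfRec-rotate (suc (suc n)) y (x ∷ w) len = begin
      laplace (pfRec (suc n)) x (w ++ y ∷ [])
        ≈⟨ laplace-snoc (pfRec (suc n)) x y w ⟩
      laplace (λ u → pfRec (suc n) (u ++ y ∷ [])) x w + negateByLength w (ψ x y · pfRec (suc n) w)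
        ≈⟨ +-cong (laplace-cong x w (λ u eq → pfRec-rotate (suc n) y u (≡.trans eq w-len)))
                  (negateByLength-even (suc n) w _ w-len) ⟩
      laplace (laplace (pfRec n) y) x w + ψ x y · pfRec (suc n) w
        ≈⟨ +-cong (+-inverseˡ-unique _ _ (laplace²-antisym (pfRec n) x y w))
                  (*-congʳ (ψ-sym x y)) ⟩
      - laplace (laplace (pfRec n) x) y w + ψ y x · pfRec (suc n) w
        ≈⟨ +-comm _ _ ⟩
      laplace (pfRec (suc n)) y (x ∷ w) ∎
      where
      w-len : length w ≡ double (suc n)
      w-len = suc-injective (suc-injective len)

module _ {c ℓ a b} (R : CommutativeRing c ℓ) {A : Set a} {B : Set b}
         (ψ : A → A → CommutativeRing.Carrier R) (f : B → A) where
  open CommutativeRing R using (_≈_; refl; trans)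
  open RingLemmas R using (sub-cong)
  private
    module L  = Laplace R ψ
    module Lf = Laplace R (λ i j → ψ (f i) (f j))

  laplace-map : ∀ h v zs → Lf.laplace (λ w → h (map f w)) v zs ≈ L.laplace h (f v) (map f zs)
  laplace-map h v []       = refl
  laplace-map h v (z ∷ zs) = sub-cong refl (laplace-map (λ w → h (f z ∷ w)) v zs)

  pfRec-map : ∀ n zs → Lf.pfRec n zs ≈ L.pfRec n (map f zs)
  pfRec-map zero    zs       = refl
  pfRec-map (suc n) []       = refl
  pfRec-map (suc n) (z ∷ zs) =
    trans (Lf.laplace-cong z zs (λ w _ → pfRec-map n w)) (laplace-map (L.pfRec n) z zs)

module PermutationSums {c ℓ} (R : CommutativeRing c ℓ) where
  open CommutativeRing R renaming (_*_ to _·_) hiding (zero)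
  open import Algebra.Properties.Ring ring using (-‿+-comm; -0#≈0#)
  open import Algebra.Properties.CommutativeSemigroup +-commutativeSemigroup using (interchange)
  open import Relation.Binary.Reasoning.Setoid setoid

  module _ {a} {A : Set a} where
    ∑ : (A → Carrier) → List A → Carrier
    ∑ f xs = foldr _+_ 0# (map f xs)

    ∑-cong : ∀ {f g} → (∀ x → f x ≈ g x) → ∀ xs → ∑ f xs ≈ ∑ g xs
    ∑-cong f≈g []       = refl
    ∑-cong f≈g (x ∷ xs) = +-cong (f≈g x) (∑-cong f≈g xs)

    ∑-++ : ∀ f xs ys → ∑ f (xs ++ ys) ≈ ∑ f xs + ∑ f ys
    ∑-++ f []       ys = sym (+-identityˡ _)
    ∑-++ f (x ∷ xs) ys = trans (+-congˡ (∑-++ f xs ys)) (sym (+-assoc _ _ _))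

    ∑-+ : ∀ f g xs → ∑ (λ x → f x + g x) xs ≈ ∑ f xs + ∑ g xs
    ∑-+ f g []       = sym (+-identityˡ _)
    ∑-+ f g (x ∷ xs) = trans (+-congˡ (∑-+ f g xs)) (interchange _ _ _ _)

    ∑-scale : ∀ α f xs → ∑ (λ x → α · f x) xs ≈ α · ∑ f xs
    ∑-scale α f []       = sym (zeroʳ α)
    ∑-scale α f (x ∷ xs) = trans (+-congˡ (∑-scale α f xs)) (sym (distribˡ α _ _))

    ∑-zero : ∀ xs → ∑ (λ _ → 0#) xs ≈ 0#
    ∑-zero []       = refl
    ∑-zero (x ∷ xs) = trans (+-identityˡ _) (∑-zero xs)

    ∑-filterᵇ : ∀ (p : A → Bool) f xs → ∑ f (filterᵇ p xs) ≈ ∑ (λ x → if p x then f x else 0#) xs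
    ∑-filterᵇ p f []       = refl
    ∑-filterᵇ p f (x ∷ xs) with p x
    ... | true  = +-congˡ (∑-filterᵇ p f xs)
    ... | false = trans (∑-filterᵇ p f xs) (sym (+-identityˡ _))

  ∑-map : ∀ {a b} {A : Set a} {B : Set b} (f : B → Carrier) (g : A → B) xs →
          ∑ f (map g xs) ≈ ∑ (λ x → f (g x)) xs
  ∑-map f g []       = refl
  ∑-map f g (x ∷ xs) = +-congˡ (∑-map f g xs)

  ∑-concatMap : ∀ {a b} {A : Set a} {B : Set b} (f : B → Carrier) (g : A → List B) xs →
                ∑ f (concatMap g xs) ≈ ∑ (λ x → ∑ f (g x)) xs
  ∑-concatMap f g []       = refl
  ∑-concatMap f g (x ∷ xs) = trans (∑-++ f (g x) (concatMap g xs)) (+-congˡ (∑-concatMap f g xs))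

  module _ {A : Set} where
    sumPerms : (List A → Carrier) → List A → Carrier
    sumPerms f L = ∑ f (perms L)

    sumInsertions : (List A → Carrier) → A → List A → Carrier
    sumInsertions f x σ = ∑ f (insertions x σ)

    -- sumPicks F (x₁ ∷ … ∷ xᵣ) = ∑ⱼ F xⱼ (the xᵢ with i ≠ j, in order).
    sumPicks : (A → List A → Carrier) → List A → Carrier
    sumPicks F []      = 0#
    sumPicks F (x ∷ L) = F x L + sumPicks (λ m r → F m (x ∷ r)) L

    sumPicks-cong : ∀ {F G} L → (∀ m r → m ∈ L → r ⊆ L → m ∷ r ↭ L → F m r ≈ G m r) →
                    sumPicks F L ≈ sumPicks G L
    sumPicks-cong []      F≈G = refl
    sumPicks-cong (x ∷ L) F≈G =
      +-cong (F≈G x L (here ≡.refl) (x ∷ʳ ⊆-refl) ↭-refl)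
             (sumPicks-cong L (λ m r m∈L r⊆L m∷r↭L →
                F≈G m (x ∷ r) (there m∈L) (≡.refl ∷ r⊆L)
                    (↭-trans (↭-swap m x ↭-refl) (↭-prep x m∷r↭L))))

    sumPicks-neg : ∀ F L → sumPicks (λ m r → - F m r) L ≈ - sumPicks F L
    sumPicks-neg F []      = sym -0#≈0#
    sumPicks-neg F (x ∷ L) = trans (+-congˡ (sumPicks-neg _ L)) (-‿+-comm _ _)

    sumPicks-zero : ∀ L → sumPicks (λ _ _ → 0#) L ≈ 0#
    sumPicks-zero []      = refl
    sumPicks-zero (x ∷ L) = trans (+-identityˡ _) (sumPicks-zero L)

    sumInsertions-cong : ∀ {f g} x σ → (∀ π → π ↭ x ∷ σ → f π ≈ g π) →
                         sumInsertions f x σ ≈ sumInsertions g x σ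
    sumInsertions-cong x []      f≈g = +-congʳ (f≈g (x ∷ []) ↭-refl)
    sumInsertions-cong {f} {g} x (m ∷ σ) f≈g = +-cong (f≈g _ ↭-refl) (begin
      ∑ f (map (m ∷_) (insertions x σ))         ≈⟨ ∑-map f (m ∷_) (insertions x σ) ⟩
      ∑ (λ π → f (m ∷ π)) (insertions x σ)
        ≈⟨ sumInsertions-cong x σ (λ π p → f≈g (m ∷ π) (↭-trans (↭-prep m p) (↭-swap m x ↭-refl))) ⟩
      ∑ (λ π → g (m ∷ π)) (insertions x σ)      ≈⟨ sym (∑-map g (m ∷_) (insertions x σ)) ⟩
      ∑ g (map (m ∷_) (insertions x σ))         ∎)

    sumPerms-cong : ∀ {f g} L → (∀ π → π ↭ L → f π ≈ g π) → sumPerms f L ≈ sumPerms g L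
    sumPerms-cong []      f≈g = +-congʳ (f≈g [] ↭-refl)
    sumPerms-cong {f} {g} (x ∷ L) f≈g = begin
      ∑ f (concatMap (insertions x) (perms L))  ≈⟨ ∑-concatMap f (insertions x) (perms L) ⟩
      ∑ (sumInsertions f x) (perms L)
        ≈⟨ sumPerms-cong L (λ σ p →
             sumInsertions-cong x σ (λ π q → f≈g π (↭-trans q (↭-prep x p)))) ⟩
      ∑ (sumInsertions g x) (perms L)           ≈⟨ sym (∑-concatMap g (insertions x) (perms L)) ⟩
      ∑ g (concatMap (insertions x) (perms L))  ∎

    sumLaterInsertions : (List A → Carrier) → A → List A → Carrier
    sumLaterInsertions f x []      = 0#
    sumLaterInsertions f x (m ∷ σ) = sumInsertions (λ π → f (m ∷ π)) x σ

    sumInsertions-split : ∀ f x σ → sumInsertions f x σ ≈ f (x ∷ σ) + sumLaterInsertions f x σ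
    sumInsertions-split f x []      = refl
    sumInsertions-split f x (m ∷ σ) = +-congˡ (∑-map f (m ∷_) (insertions x σ))

    sumPerms-byHead : ∀ f x L →
                      sumPerms f (x ∷ L) ≈ sumPicks (λ m r → sumPerms (λ π → f (m ∷ π)) r) (x ∷ L)
    sumPerms-byHead f x L = begin
      ∑ f (concatMap (insertions x) (perms L))        ≈⟨ ∑-concatMap f (insertions x) (perms L) ⟩
      ∑ (sumInsertions f x) (perms L)                 ≈⟨ ∑-cong (sumInsertions-split f x) (perms L) ⟩
      ∑ (λ σ → f (x ∷ σ) + later σ) (perms L)         ≈⟨ ∑-+ _ _ (perms L) ⟩
      sumPerms (λ σ → f (x ∷ σ)) L + sumPerms later L ≈⟨ +-congˡ (laterByHead L) ⟩
      sumPerms (λ σ → f (x ∷ σ)) L + sumPicks (λ m r → sumPerms (λ π → later (m ∷ π)) r) L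
        ≈⟨ +-congˡ (sumPicks-cong L (λ m r _ _ _ →
             sym (∑-concatMap (λ π → f (m ∷ π)) (insertions x) (perms r)))) ⟩
      sumPicks (λ m r → sumPerms (λ π → f (m ∷ π)) r) (x ∷ L) ∎
      where
      later : List A → Carrier
      later = sumLaterInsertions f x

      laterByHead : ∀ L →
                    sumPerms later L ≈ sumPicks (λ m r → sumPerms (λ π → later (m ∷ π)) r) L
      laterByHead []      = +-identityʳ 0#
      laterByHead (y ∷ L) = sumPerms-byHead later y L

module _ {k : ℕ} where
  <ᵇ≡true⇒< : ∀ {i j : Fin k} → i <ᵇ j ≡ true → i < j
  <ᵇ≡true⇒< {i} {j} i<ᵇj = ℕₚ.<ᵇ⇒< (toℕ i) (toℕ j) (≡.subst T (≡.sym i<ᵇj) tt)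

  <⇒<ᵇ≡true : ∀ {i j : Fin k} → i < j → i <ᵇ j ≡ true
  <⇒<ᵇ≡true {i} {j} = dec-true (toℕ i <? toℕ j)

  >⇒<ᵇ≡false : ∀ {i j : Fin k} → j < i → i <ᵇ j ≡ false
  >⇒<ᵇ≡false {i} {j} j<i = dec-false (toℕ i <? toℕ j) (<-asym j<i)

  Sorted : List (Fin k) → Set
  Sorted = AllPairs _<_

  Sorted-⊆ : ∀ {xs ys} → xs ⊆ ys → Sorted ys → Sorted xs
  Sorted-⊆ []               sorted          = sorted
  Sorted-⊆ (y ∷ʳ xs⊆ys)     (_ ∷ sorted)    = Sorted-⊆ xs⊆ys sorted
  Sorted-⊆ (≡.refl ∷ xs⊆ys) (y<ys ∷ sorted) = All-resp-⊆ xs⊆ys y<ys ∷ Sorted-⊆ xs⊆ys sorted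

  countBelow-min : ∀ {l} xs → All (l <_) xs → countBelow l xs ≡ 0
  countBelow-min []       []           = ≡.refl
  countBelow-min (x ∷ xs) (l<x ∷ l<xs) rewrite >⇒<ᵇ≡false l<x = countBelow-min xs l<xs

  countBelow-∷< : ∀ {m x} r → x < m → countBelow m (x ∷ r) ≡ suc (countBelow m r)
  countBelow-∷< r x<m rewrite <⇒<ᵇ≡true x<m = ≡.refl

  indicator : Fin k → Fin k → ℕ
  indicator x m = if x <ᵇ m then 1 else 0

  countBelow-↭ : ∀ {m xs ys} → xs ↭ ys → countBelow m xs ≡ countBelow m ys
  countBelow-↭     ↭.refl         = ≡.refl
  countBelow-↭ {m} (↭.prep x p)   = ≡.cong (indicator x m ℕ.+_) (countBelow-↭ p)
  countBelow-↭ {m} (↭.swap x y p) = ≡.trans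
    (≡.cong (λ t → indicator x m ℕ.+ (indicator y m ℕ.+ t)) (countBelow-↭ p))
    (x∙yz≈y∙xz (indicator x m) (indicator y m) _)
    where open import Algebra.Properties.CommutativeSemigroup ℕₚ.+-commutativeSemigroup using (x∙yz≈y∙xz)
  countBelow-↭     (↭.trans p q)  = ≡.trans (countBelow-↭ p) (countBelow-↭ q)

  incFirst-∷ : ∀ {l m} π → All (l <_) π → incFirst ((l , m) ∷ pairs π) ≡ incFirst (pairs π)
  incFirst-∷ []          _         = ≡.refl
  incFirst-∷ (i ∷ [])    _         = ≡.refl
  incFirst-∷ (i ∷ j ∷ ρ) (l<i ∷ _) rewrite <⇒<ᵇ≡true l<i = ≡.refl

  pfAdmissible-minPair : ∀ {l m} π → l < m → All (l <_) π →
                         pfAdmissible (l ∷ m ∷ π) ≡ pfAdmissible π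
  pfAdmissible-minPair {m = m} π l<m l<π rewrite incFirst-∷ {m = m} π l<π | <⇒<ᵇ≡true l<m = ≡.refl

  inversions-minPair : ∀ {l m} π → l < m → All (l <_) π →
                       inversions (l ∷ m ∷ π) ≡ countBelow m π ℕ.+ inversions π
  inversions-minPair π l<m l<π rewrite countBelow-min (_ ∷ π) (l<m ∷ l<π) = ≡.refl

  pfAdmissible⇒headMin : ∀ n i j ρ → length ρ ≡ double n → pfAdmissible (i ∷ j ∷ ρ) ≡ true →
                         All (i <_) (j ∷ ρ)
  pfAdmissible⇒headMin zero i j [] _ adm = <ᵇ≡true⇒< (∧-conicalˡ (i <ᵇ j) _ adm) ∷ []
  pfAdmissible⇒headMin (suc n) i j (i′ ∷ j′ ∷ ρ) len adm =
    <ᵇ≡true⇒< i<ᵇj ∷ <ᵇ≡true⇒< i<ᵇi′ ∷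
    All.map (ℕₚ.<-trans (<ᵇ≡true⇒< i<ᵇi′))
            (pfAdmissible⇒headMin n i′ j′ ρ (suc-injective (suc-injective len))
                                  admissible′)
    where
    rest : List (Fin k × Fin k)
    rest = (i′ , j′) ∷ pairs ρ

    increasing : (i <ᵇ i′) ∧ incFirst rest ≡ true
    increasing = ∧-conicalˡ _ _ adm

    upward : (i <ᵇ j) ∧ allLt rest ≡ true
    upward = ∧-conicalʳ ((i <ᵇ i′) ∧ incFirst rest) _ adm

    i<ᵇi′ : i <ᵇ i′ ≡ true
    i<ᵇi′ = ∧-conicalˡ _ _ increasing

    i<ᵇj : i <ᵇ j ≡ true
    i<ᵇj = ∧-conicalˡ _ _ upward

    admissible′ : pfAdmissible (i′ ∷ j′ ∷ ρ) ≡ true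
    admissible′ =
      ≡.cong₂ _∧_ (∧-conicalʳ (i <ᵇ i′) _ increasing) (∧-conicalʳ (i <ᵇ j) _ upward)

module Expansion {c ℓ} (R : CommutativeRing c ℓ) {k : ℕ}
                 (a : Fin k → Fin k → CommutativeRing.Carrier R) where
  open CommutativeRing R renaming (_*_ to _·_) hiding (zero)
  open import Algebra.Properties.Ring ring using (-‿involutive; -‿distribˡ-*)
  open RingLemmas R
  open PermutationSums R
  open Laplace R a
  open import Relation.Binary.Reasoning.Setoid setoid

  signℕ : ℕ → Carrier
  signℕ n = if isEven n then 1# else - 1#

  signℕ-suc : ∀ n → signℕ (suc n) ≈ - signℕ n
  signℕ-suc n with isEven n
  ... | true  = refl
  ... | false = sym (-‿involutive 1#)

  signℕ-+ : ∀ m n → signℕ (m ℕ.+ n) ≈ signℕ m · signℕ n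
  signℕ-+ zero    n = sym (*-identityˡ _)
  signℕ-+ (suc m) n = begin
    signℕ (suc (m ℕ.+ n))   ≈⟨ signℕ-suc (m ℕ.+ n) ⟩
    - signℕ (m ℕ.+ n)       ≈⟨ -‿cong (signℕ-+ m n) ⟩
    - (signℕ m · signℕ n)   ≈⟨ -‿distribˡ-* _ _ ⟩
    (- signℕ m) · signℕ n   ≈⟨ *-congʳ (sym (signℕ-suc m)) ⟩
    signℕ (suc m) · signℕ n ∎

  entry : Fin k × Fin k → Carrier
  entry (i , j) = a i j

  term : List (Fin k) → Carrier
  term π = if pfAdmissible π then sign R π · foldr _·_ 1# (map entry (pairs π)) else 0#

  term-minPair : ∀ {l m} π → l < m → All (l <_) π →
                 term (l ∷ m ∷ π) ≈ signℕ (countBelow m π) · (a l m · term π)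
  term-minPair {l} {m} π l<m l<π rewrite pfAdmissible-minPair π l<m l<π with pfAdmissible π
  ... | true  = begin
    sign R (l ∷ m ∷ π) · (a l m · product)
      ≈⟨ *-congʳ (trans (reflexive (≡.cong signℕ (inversions-minPair π l<m l<π)))
                        (signℕ-+ (countBelow m π) (inversions π))) ⟩
    (signℕ (countBelow m π) · sign R π) · (a l m · product)
      ≈⟨ [xy][zw]≈x[z[yw]] _ _ _ _ ⟩
    signℕ (countBelow m π) · (a l m · (sign R π · product)) ∎
    where
    product : Carrier
    product = foldr _·_ 1# (map entry (pairs π))
  ... | false = sym (trans (*-congˡ (zeroʳ _)) (zeroʳ _))

  term-nonMinHead : ∀ n {l m} j ρ → length ρ ≡ double n → l < m → l ∈ j ∷ ρ →
                    term (m ∷ j ∷ ρ) ≈ 0#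
  term-nonMinHead n {l} {m} j ρ len l<m l∈ with pfAdmissible (m ∷ j ∷ ρ) in adm
  ... | true  = ⊥-elim (<-asym l<m (All.lookup (pfAdmissible⇒headMin n m j ρ len adm) l∈))
  ... | false = refl

  sumPicks-signed : ∀ v L h → Sorted L →
                    sumPicks (λ m r → signℕ (countBelow m r) · (a v m · h r)) L ≈ laplace h v L
  sumPicks-signed v []      h _               = refl
  sumPicks-signed v (x ∷ L) h (x<L ∷ sorted) = +-cong headTerm (begin
    sumPicks (λ m r → signℕ (countBelow m (x ∷ r)) · (a v m · h (x ∷ r))) L
      ≈⟨ sumPicks-cong L (λ m r m∈L _ _ → signFlips m r (All.lookup x<L m∈L)) ⟩
    sumPicks (λ m r → - (signℕ (countBelow m r) · (a v m · h (x ∷ r)))) L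
      ≈⟨ sumPicks-neg _ L ⟩
    - sumPicks (λ m r → signℕ (countBelow m r) · (a v m · h (x ∷ r))) L
      ≈⟨ -‿cong (sumPicks-signed v L (λ w → h (x ∷ w)) sorted) ⟩
    - laplace (λ w → h (x ∷ w)) v L ∎)
    where
    headTerm : signℕ (countBelow x L) · (a v x · h L) ≈ a v x · h L
    headTerm rewrite countBelow-min L x<L = *-identityˡ _

    signFlips : ∀ m r → x < m → signℕ (countBelow m (x ∷ r)) · (a v m · h (x ∷ r)) ≈
                                 - (signℕ (countBelow m r) · (a v m · h (x ∷ r)))
    signFlips m r x<m = trans (*-congʳ (trans (reflexive (≡.cong signℕ (countBelow-∷< r x<m)))
                                              (signℕ-suc (countBelow m r))))
                              (sym (-‿distribˡ-* _ _))

  sumPerms-minHead : ∀ n l L → All (l <_) L → Sorted L → length L ≡ suc (double n) →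
                     (∀ r → Sorted r → length r ≡ double n → sumPerms term r ≈ pfRec n r) →
                     sumPerms (λ π → term (l ∷ π)) L ≈ laplace (pfRec n) l L
  sumPerms-minHead n l (x ∷ L) l<L sorted len sumPerms≈pfRec = begin
    sumPerms (λ π → term (l ∷ π)) (x ∷ L)
      ≈⟨ sumPerms-byHead _ x L ⟩
    sumPicks (λ m r → sumPerms (λ π → term (l ∷ m ∷ π)) r) (x ∷ L)
      ≈⟨ sumPicks-cong (x ∷ L) pick ⟩
    sumPicks (λ m r → signℕ (countBelow m r) · (a l m · pfRec n r)) (x ∷ L)
      ≈⟨ sumPicks-signed l (x ∷ L) (pfRec n) sorted ⟩
    laplace (pfRec n) l (x ∷ L) ∎
    where
    pick : ∀ m r → m ∈ x ∷ L → r ⊆ x ∷ L → m ∷ r ↭ x ∷ L →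
           sumPerms (λ π → term (l ∷ m ∷ π)) r ≈ signℕ (countBelow m r) · (a l m · pfRec n r)
    pick m r m∈ r⊆ m∷r↭ = begin
      sumPerms (λ π → term (l ∷ m ∷ π)) r
        ≈⟨ sumPerms-cong r (λ π π↭r →
             trans (term-minPair π l<m (All-resp-↭ (↭-sym π↭r) (All-resp-⊆ r⊆ l<L)))
                   (*-congʳ (reflexive (≡.cong signℕ (countBelow-↭ π↭r))))) ⟩
      ∑ (λ π → signℕ (countBelow m r) · (a l m · term π)) (perms r)
        ≈⟨ ∑-scale _ _ (perms r) ⟩
      signℕ (countBelow m r) · ∑ (λ π → a l m · term π) (perms r)
        ≈⟨ *-congˡ (∑-scale _ _ (perms r)) ⟩
      signℕ (countBelow m r) · (a l m · sumPerms term r)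
        ≈⟨ *-congˡ (*-congˡ (sumPerms≈pfRec r (Sorted-⊆ r⊆ sorted) (↭-length-∷ m∷r↭ len))) ⟩
      signℕ (countBelow m r) · (a l m · pfRec n r) ∎
      where
      l<m : l < m
      l<m = All.lookup l<L m∈

  sumPicks-nonMinHead : ∀ n l L → All (l <_) L → length L ≡ suc (double n) →
                        sumPicks (λ m r → sumPerms (λ π → term (m ∷ π)) (l ∷ r)) L ≈ 0#
  sumPicks-nonMinHead n l L l<L len = trans (sumPicks-cong L vanish) (sumPicks-zero L)
    where
    vanish : ∀ m r → m ∈ L → r ⊆ L → m ∷ r ↭ L → sumPerms (λ π → term (m ∷ π)) (l ∷ r) ≈ 0#
    vanish m r m∈ _ m∷r↭ = trans (sumPerms-cong (l ∷ r) termVanishes) (∑-zero (perms (l ∷ r)))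
      where
      termVanishes : ∀ π → π ↭ l ∷ r → term (m ∷ π) ≈ 0#
      termVanishes []      π↭ with () ← ↭-length π↭
      termVanishes (j ∷ ρ) π↭ =
        term-nonMinHead n j ρ (≡.trans (suc-injective (↭-length π↭)) (↭-length-∷ m∷r↭ len))
                        (All.lookup l<L m∈) (∈-resp-↭ (↭-sym π↭) (here ≡.refl))

  sumPerms-term : ∀ n L → Sorted L → length L ≡ double n → sumPerms term L ≈ pfRec n L
  sumPerms-term zero    []      _              _   = trans (+-identityʳ _) (*-identityˡ 1#)
  sumPerms-term (suc n) (l ∷ L) (l<L ∷ sorted) len = begin
    sumPerms term (l ∷ L)
      ≈⟨ sumPerms-byHead term l L ⟩
    sumPerms (λ π → term (l ∷ π)) L +
    sumPicks (λ m r → sumPerms (λ π → term (m ∷ π)) (l ∷ r)) L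
      ≈⟨ +-cong (sumPerms-minHead n l L l<L sorted (suc-injective len) (sumPerms-term n))
                (sumPicks-nonMinHead n l L l<L (suc-injective len)) ⟩
    laplace (pfRec n) l L + 0#
      ≈⟨ +-identityʳ _ ⟩
    pfRec (suc n) (l ∷ L) ∎

module _ {c ℓ} (R : CommutativeRing c ℓ)
         (ψ : CommutativeRing.Carrier R → CommutativeRing.Carrier R → CommutativeRing.Carrier R) where
  open CommutativeRing R renaming (_*_ to _·_) hiding (zero)
  open PermutationSums R
  open Laplace R ψ using (pfRec)
  open import Relation.Binary.Reasoning.Setoid setoid

  pf≈pfRec : ∀ n ys → length ys ≡ double n → pf R ψ ys ≈ pfRec n ys
  pf≈pfRec n ys len = begin
    pf R ψ ys
      ≈⟨ trans (∑-filterᵇ pfAdmissible _ (perms (allFin k)))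
               (∑-cong (λ π → reflexive (≡.cong (summand π) (map-cong (λ { (i , j) → ≡.refl }) (pairs π))))
                       (perms (allFin k))) ⟩
    sumPerms E.term (allFin k)
      ≈⟨ E.sumPerms-term n (allFin k) (tabulate⁺-< id) (≡.trans (length-tabulate id) len) ⟩
    Laplace.pfRec R entries n (allFin k)
      ≈⟨ pfRec-map R ψ (lookup ys) n (allFin k) ⟩
    pfRec n (map (lookup ys) (allFin k))
      ≡⟨ ≡.cong (pfRec n) (≡.trans (map-tabulate id (lookup ys)) (tabulate-lookup ys)) ⟩
    pfRec n ys ∎
    where
    k : ℕ
    k = length ys

    entries : Fin k → Fin k → Carrier
    entries i j = ψ (lookup ys i) (lookup ys j)

    summand : List (Fin k) → List Carrier → Carrier
    summand π t = if pfAdmissible π then sign R π · foldr _·_ 1# t else 0#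

    module E = Expansion R entries

x+x≈0⇒x≈0 : ∀ {c ℓ} (K : CommutativeRing c ℓ) → IsField K → CharNot2 K →
            let open CommutativeRing K in ∀ x → x + x ≈ 0# → x ≈ 0#
x+x≈0⇒x≈0 K (_ , inverse) char≢2 x x+x≈0 = begin
  x                     ≈⟨ sym (*-identityˡ x) ⟩
  1# · x                ≈⟨ *-congʳ (sym (trans (*-comm w _) 2w≈1)) ⟩
  (w · (1# + 1#)) · x   ≈⟨ *-assoc w _ x ⟩
  w · ((1# + 1#) · x)   ≈⟨ *-congˡ (distribʳ x 1# 1#) ⟩
  w · (1# · x + 1# · x) ≈⟨ *-congˡ (+-cong (*-identityˡ x) (*-identityˡ x)) ⟩
  w · (x + x)           ≈⟨ *-congˡ x+x≈0 ⟩
  w · 0#                ≈⟨ zeroʳ w ⟩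
  0#                    ∎
  where
  open CommutativeRing K renaming (_*_ to _·_) hiding (zero)
  open import Relation.Binary.Reasoning.Setoid setoid

  w : Carrier
  w = proj₁ (inverse (1# + 1#) char≢2)

  2w≈1 : (1# + 1#) · w ≈ 1#
  2w≈1 = proj₂ (inverse (1# + 1#) char≢2)

theorem1p2 : {a ℓ : Level} (K : CommutativeRing a ℓ) → IsField K → CharNot2 K →
    let open CommutativeRing K hiding (_*_) in
    (ψ : Carrier → Carrier → Carrier) →
    (∀ {x x' y y'} → x ≈ x' → y ≈ y' → ψ x y ≈ ψ x' y') →
    (∀ x y → ψ x y ≈ ψ y x) →
    (∀ x y z → ψ (x + z) (y + z) ≈ ψ x y) →
    (n : ℕ) → 1 ≤ n →
    ((xs : List Carrier) (y : Carrier) (zs : List Carrier) →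
       length (xs ++ y ∷ y ∷ zs) ≡ 2 * n →
       pf K ψ (xs ++ y ∷ y ∷ zs) ≈ CommutativeRing._*_ K (ψ 0# 0#) (pf K ψ (xs ++ zs)))
    ×
    ((y : Carrier) (zs : List Carrier) →
       length (y ∷ zs ++ y ∷ []) ≡ 2 * n →
       pf K ψ (y ∷ zs ++ y ∷ []) ≈ CommutativeRing._*_ K (ψ 0# 0#) (pf K ψ zs))
theorem1p2 K isField char≢2 ψ ψ-cong ψ-sym ψ-shift (suc n) _ = adjacent , cyclic
  where
  open CommutativeRing K renaming (_*_ to _·_) hiding (zero)
  open Laplace K ψ using (pfRec; pfRec-dup; pfRec-rotate)
  open import Relation.Binary.Reasoning.Setoid setoid

  ψ-diag : ∀ y → ψ y y ≈ ψ 0# 0#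
  ψ-diag y = trans (ψ-cong (sym (+-identityˡ y)) (sym (+-identityˡ y))) (ψ-shift 0# 0# y)

  adjacent : ∀ xs y zs → length (xs ++ y ∷ y ∷ zs) ≡ 2 * suc n →
             pf K ψ (xs ++ y ∷ y ∷ zs) ≈ ψ 0# 0# · pf K ψ (xs ++ zs)
  adjacent xs y zs len = begin
    pf K ψ (xs ++ y ∷ y ∷ zs)
      ≈⟨ pf≈pfRec K ψ (suc n) (xs ++ y ∷ y ∷ zs) len₂ₙ₊₂ ⟩
    pfRec (suc n) (xs ++ y ∷ y ∷ zs)
      ≈⟨ pfRec-dup y (x+x≈0⇒x≈0 K isField char≢2) n xs zs len₂ₙ ⟩
    ψ y y · pfRec n (xs ++ zs)
      ≈⟨ *-cong (ψ-diag y) (sym (pf≈pfRec K ψ n (xs ++ zs) len₂ₙ)) ⟩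
    ψ 0# 0# · pf K ψ (xs ++ zs) ∎
    where
    len₂ₙ₊₂ : length (xs ++ y ∷ y ∷ zs) ≡ double (suc n)
    len₂ₙ₊₂ = ≡.trans len (≡.sym (double≡2* (suc n)))

    len₂ₙ : length (xs ++ zs) ≡ double n
    len₂ₙ = suc-injective (suc-injective (≡.trans
      (≡.sym (≡.trans (length-++-sucʳ xs y (y ∷ zs)) (≡.cong suc (length-++-sucʳ xs y zs))))
      len₂ₙ₊₂))

  cyclic : ∀ y zs → length (y ∷ zs ++ y ∷ []) ≡ 2 * suc n →
           pf K ψ (y ∷ zs ++ y ∷ []) ≈ ψ 0# 0# · pf K ψ zs
  cyclic y zs len = begin
    pf K ψ (y ∷ zs ++ y ∷ [])
      ≈⟨ pf≈pfRec K ψ (suc n) (y ∷ zs ++ y ∷ []) len₂ₙ₊₂ ⟩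
    pfRec (suc n) (y ∷ zs ++ y ∷ [])
      ≈⟨ pfRec-rotate ψ-sym (suc n) y (y ∷ zs) len′ ⟩
    pfRec (suc n) (y ∷ y ∷ zs)
      ≈⟨ sym (pf≈pfRec K ψ (suc n) (y ∷ y ∷ zs) len′) ⟩
    pf K ψ (y ∷ y ∷ zs)
      ≈⟨ adjacent [] y zs (≡.trans len′ (double≡2* (suc n))) ⟩
    ψ 0# 0# · pf K ψ zs ∎
    where
    len₂ₙ₊₂ : length (y ∷ zs ++ y ∷ []) ≡ double (suc n)
    len₂ₙ₊₂ = ≡.trans len (≡.sym (double≡2* (suc n)))

    len′ : length (y ∷ y ∷ zs) ≡ double (suc n)
    len′ = ≡.trans (≡.cong suc (≡.sym (length-++-comm zs (y ∷ [])))) len₂ₙ₊₂
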